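{- Let $\phi$ be a formula of the word fragment of $\mathsf{POL}^-$. Then $\phi$ is satisfiable (in some pointed epistemic expectation model) if and only if $tr(\phi)$ is satisfiable in $\mathsf{PAL}$ (in some pointed epistemic model).
   Context: Fix a finite set $Agt$ of agents, a countable set $\mathcal{P}$ of propositional variables and a finite alphabet $\Sigma$. Observation expressions: $\pi ::= \emptyset \mid \varepsilon \mid a \mid \pi\cdot\pi \mid \pi+\pi$ ($a\in\Sigma$), with finite language $\mathcal{L}(\pi)\subseteq\Sigma^*$; $\pi\backslash w:=\{v\mid wv\in\mathcal{L}(\pi)\}$ and $\mathit{Pre}(\pi)=\{w\mid\pi\backslash w\neq\emptyset\}$. An epistemic expectation model is $\mathcal{M}=\langle S,\sim,V,\mathit{Exp}\rangle$: $S$ non-empty, $\sim_i$ an equivalence relation on $S$ for each $i\in Agt$, $V:S\to 2^{\mathcal{P}}$, $\mathit{Exp}(s)$ an observation expression with non-empty language. $\mathcal{M}|_w$ keeps the states $s$ with $\mathit{Exp}(s)\backslash w\neq\emptyset$, restricts $\sim$ and $V$, and sets $\mathit{Exp}'(s)=\mathit{Exp}(s)\backslash w$. $\mathsf{POL}^-$ formulas: $\phi::=\top\mid p\mid\neg\phi\mid\phi\wedge\phi\mid K_i\phi\mid[\pi]\phi$, $\langle\pi\rangle\phi:=\neg[\pi]\neg\phi$, with $\mathcal{M},s\models K_i\phi$ iff $\phi$ holds at all $\sim_i$-successors, and $\mathcal{M},s\models[\pi]\phi$ iff $\mathcal{M}|_w,s\models\phi$ for every $w\in\mathcal{L}(\pi)\cap\mathit{Pre}(\mathit{Exp}(s))$.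 The word fragment consists of formulas whose observation expressions are words (no $+$); a modality $\langle a_1\cdots a_k\rangle$ is rewritten as $\langle a_1\rangle\cdots\langle a_k\rangle$, so modalities contain single letters. $\mathsf{PAL}$: formulas $\phi::=\top\mid p\mid\neg\phi\mid\phi\wedge\phi\mid K_i\phi\mid[\phi!]\phi$, $\langle\psi!\rangle\phi:=\neg[\psi!]\neg\phi$, interpreted on epistemic models $\langle S,\sim,V\rangle$ with $\mathcal{M},s\models[\psi!]\phi$ iff ($\mathcal{M},s\models\psi$ implies $\mathcal{M}|_\psi,s\models\phi$), where $\mathcal{M}|_\psi$ restricts the model to the states satisfying $\psi$. The translation uses fresh propositional variables $p_u$ for $u\in\Sigma^*$, and for each $w\in\Sigma^*$: $tr_w(p)=p$, $tr_w(\neg\phi)=\neg tr_w(\phi)$, $tr_w(\phi\wedge\psi)=tr_w(\phi)\wedge tr_w(\psi)$, $tr_w(K_i\phi)=K_i tr_w(\phi)$, $tr_w(\langle a\rangle\phi)=\langle p_{wa}!\rangle tr_{wa}(\phi)$ (so $tr_w([a]\phi)=[p_{wa}!]tr_{wa}(\phi)$); finally $tr(\phi):=tr_\varepsilon(\phi)$. -}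

module Defs where

open import Data.Nat using (ℕ)
open import Data.Fin using (Fin)
open import Data.Fin.Properties using (_≟_)
open import Data.List using (List; []; _∷_; _++_)
open import Data.Bool using (Bool; true; false; if_then_else_)
open import Data.Product using (Σ; ∃; ∃₂; _×_; _,_; proj₁; proj₂)
open import Data.Sum using (_⊎_; inj₁; inj₂)
open import Data.Empty using (⊥)
open import Data.Unit using (⊤; tt)
open import Relation.Binary.PropositionalEquality using (_≡_; refl)
open import Relation.Binary.Structures using (IsEquivalence)
open import Relation.Nullary using (¬_; does; yes; no)

module Logic (n k : ℕ) (P : Set) where

  Agt : Set
  Agt = Fin n

  Letter : Set
  Letter = Fin k

  Word : Set
  Word = List Letter

  infixl 7 _·_
  infixl 6 _⊕_

  data Obs : Set where
    ∅ₒ  : Obs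
    εₒ  : Obs
    sym : Letter → Obs
    _·_ : Obs → Obs → Obs
    _⊕_ : Obs → Obs → Obs

  _∈L_ : Word → Obs → Set
  w ∈L ∅ₒ = ⊥
  w ∈L εₒ = w ≡ []
  w ∈L sym a = w ≡ a ∷ []
  w ∈L (π₁ · π₂) = ∃₂ λ u v → (w ≡ u ++ v) × (u ∈L π₁) × (v ∈L π₂)
  w ∈L (π₁ ⊕ π₂) = (w ∈L π₁) ⊎ (w ∈L π₂)

  Pre : Obs → Word → Set
  Pre π w = ∃ λ v → (w ++ v) ∈L π

  -- Syntactic (Brzozowski) residual, an observation expression
  -- whose language is π\w (see deriv-complete for the direction needed).
  nullable : Obs → Bool
  nullable ∅ₒ = false
  nullable εₒ = true
  nullable (sym a) = false
  nullable (π₁ · π₂) with nullable π₁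
  ... | true = nullable π₂
  ... | false = false
  nullable (π₁ ⊕ π₂) with nullable π₁
  ... | true = true
  ... | false = nullable π₂

  deriv₁ : Obs → Letter → Obs
  deriv₁ ∅ₒ a = ∅ₒ
  deriv₁ εₒ a = ∅ₒ
  deriv₁ (sym b) a = if does (a ≟ b) then εₒ else ∅ₒ
  deriv₁ (π₁ · π₂) a =
    (deriv₁ π₁ a · π₂) ⊕ (if nullable π₁ then deriv₁ π₂ a else ∅ₒ)
  deriv₁ (π₁ ⊕ π₂) a = deriv₁ π₁ a ⊕ deriv₁ π₂ a

  deriv : Obs → Word → Obs
  deriv π [] = π
  deriv π (a ∷ w) = deriv (deriv₁ π a) w

  nullable-complete : ∀ π → [] ∈L π → nullable π ≡ true
  nullable-complete εₒ h = refl
  nullable-complete (π₁ · π₂) ([] , [] , e , h₁ , h₂) with nullable π₁ | nullable-complete π₁ h₁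
  ... | true | refl = nullable-complete π₂ h₂
  nullable-complete (π₁ · π₂) ([] , _ ∷ _ , () , _)
  nullable-complete (π₁ · π₂) (_ ∷ _ , _ , () , _)
  nullable-complete (π₁ ⊕ π₂) (inj₁ h) with nullable π₁ | nullable-complete π₁ h
  ... | true | refl = refl
  nullable-complete (π₁ ⊕ π₂) (inj₂ h) with nullable π₁
  ... | true = refl
  ... | false = nullable-complete π₂ h

  deriv₁-complete : ∀ π a v → (a ∷ v) ∈L π → v ∈L deriv₁ π a
  deriv₁-complete (sym b) a v refl with a ≟ b
  ... | yes _ = refl
  ... | no ¬p = ¬p refl
  deriv₁-complete (π₁ · π₂) a v ([] , v' , refl , h₁ , h₂)
    with nullable π₁ | nullable-complete π₁ h₁
  ... | true | refl = inj₂ (deriv₁-complete π₂ a v h₂)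
  deriv₁-complete (π₁ · π₂) a .(u ++ v') (.a ∷ u , v' , refl , h₁ , h₂) =
    inj₁ (u , v' , refl , deriv₁-complete π₁ a u h₁ , h₂)
  deriv₁-complete (π₁ ⊕ π₂) a v (inj₁ h) = inj₁ (deriv₁-complete π₁ a v h)
  deriv₁-complete (π₁ ⊕ π₂) a v (inj₂ h) = inj₂ (deriv₁-complete π₂ a v h)

  deriv-complete : ∀ π w v → (w ++ v) ∈L π → v ∈L deriv π w
  deriv-complete π [] v h = h
  deriv-complete π (a ∷ w) v h =
    deriv-complete (deriv₁ π a) w v (deriv₁-complete π a (w ++ v) h)

  restrictEquiv : {S : Set} {R : S → S → Set} (Q : S → Set) →
    IsEquivalence R → IsEquivalence (λ (x y : Σ S Q) → R (proj₁ x) (proj₁ y))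
  restrictEquiv Q e = record
    { refl = IsEquivalence.refl e
    ; sym = IsEquivalence.sym e
    ; trans = IsEquivalence.trans e
    }

  record EEModel : Set₁ where
    field
      S     : Set
      R     : Agt → S → S → Set
      equiv : ∀ i → IsEquivalence (R i)
      V     : S → P → Bool
      Exp   : S → Obs
      Exp-ne : ∀ s → ∃ λ w → w ∈L Exp s

  _∣_ : EEModel → Word → EEModel
  M ∣ w = record
    { S = Σ S (λ s → Pre (Exp s) w)
    ; R = λ i x y → R i (proj₁ x) (proj₁ y)
    ; equiv = λ i → restrictEquiv (λ s → Pre (Exp s) w) (equiv i)
    ; V = λ x → V (proj₁ x)
    ; Exp = λ x → deriv (Exp (proj₁ x)) w
    ; Exp-ne = λ x → proj₁ (proj₂ x) , deriv-complete (Exp (proj₁ x)) w _ (proj₂ (proj₂ x))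
    }
    where open EEModel M

  data Fm : Set where
    ⊤ᶠ   : Fm
    varᶠ : P → Fm
    ¬ᶠ   : Fm → Fm
    _∧ᶠ_ : Fm → Fm → Fm
    Kᶠ   : Agt → Fm → Fm
    [_]ᶠ : Obs → Fm → Fm

  _,_⊨_ : (M : EEModel) → EEModel.S M → Fm → Set
  M , s ⊨ ⊤ᶠ = ⊤
  M , s ⊨ varᶠ p = EEModel.V M s p ≡ true
  M , s ⊨ ¬ᶠ φ = ¬ (M , s ⊨ φ)
  M , s ⊨ (φ ∧ᶠ ψ) = (M , s ⊨ φ) × (M , s ⊨ ψ)
  M , s ⊨ Kᶠ i φ = ∀ t → EEModel.R M i s t → M , t ⊨ φ
  M , s ⊨ [ π ]ᶠ φ =
    ∀ w → w ∈L π → (h : Pre (EEModel.Exp M s) w) → (M ∣ w) , (s , h) ⊨ φ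

  -- Word fragment (after rewriting ⟨a₁⋯aₖ⟩ as ⟨a₁⟩⋯⟨aₖ⟩): single-letter modalities
  data WFm : Set where
    ⊤ʷ   : WFm
    varʷ : P → WFm
    ¬ʷ   : WFm → WFm
    _∧ʷ_ : WFm → WFm → WFm
    Kʷ   : Agt → WFm → WFm
    [_]ʷ : Letter → WFm → WFm

  embed : WFm → Fm
  embed ⊤ʷ = ⊤ᶠ
  embed (varʷ p) = varᶠ p
  embed (¬ʷ φ) = ¬ᶠ (embed φ)
  embed (φ ∧ʷ ψ) = embed φ ∧ᶠ embed ψ
  embed (Kʷ i φ) = Kᶠ i (embed φ)
  embed ([ a ]ʷ φ) = [ sym a ]ᶠ (embed φ)

  SatPOL : Fm → Set₁
  SatPOL φ = Σ EEModel λ M → Σ (EEModel.S M) λ s → M , s ⊨ φ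

  -- PAL over P ∪ {p_u | u ∈ Σ*}  (fresh variables p_u = inj₂ u)
  PVar : Set
  PVar = P ⊎ Word

  record EModel : Set₁ where
    field
      S     : Set
      R     : Agt → S → S → Set
      equiv : ∀ i → IsEquivalence (R i)
      V     : S → PVar → Bool

  restrictBy : (M : EModel) → (EModel.S M → Set) → EModel
  restrictBy M Q = record
    { S = Σ S Q
    ; R = λ i x y → R i (proj₁ x) (proj₁ y)
    ; equiv = λ i → restrictEquiv Q (equiv i)
    ; V = λ x → V (proj₁ x)
    }
    where open EModel M

  data PFm : Set where
    ⊤ᵖ   : PFm
    varᵖ : PVar → PFm
    ¬ᵖ   : PFm → PFm
    _∧ᵖ_ : PFm → PFm → PFm
    Kᵖ   : Agt → PFm → PFm
    [_!]_ : PFm → PFm → PFm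

  _,_⊨ᵖ_ : (M : EModel) → EModel.S M → PFm → Set
  M , s ⊨ᵖ ⊤ᵖ = ⊤
  M , s ⊨ᵖ varᵖ p = EModel.V M s p ≡ true
  M , s ⊨ᵖ ¬ᵖ φ = ¬ (M , s ⊨ᵖ φ)
  M , s ⊨ᵖ (φ ∧ᵖ ψ) = (M , s ⊨ᵖ φ) × (M , s ⊨ᵖ ψ)
  M , s ⊨ᵖ Kᵖ i φ = ∀ t → EModel.R M i s t → M , t ⊨ᵖ φ
  M , s ⊨ᵖ ([ ψ !] φ) =
    (h : M , s ⊨ᵖ ψ) → restrictBy M (λ t → M , t ⊨ᵖ ψ) , (s , h) ⊨ᵖ φ

  SatPAL : PFm → Set₁
  SatPAL φ = Σ EModel λ M → Σ (EModel.S M) λ s → M , s ⊨ᵖ φ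

  ⟨_!⟩_ : PFm → PFm → PFm
  ⟨ ψ !⟩ φ = ¬ᵖ ([ ψ !] ¬ᵖ φ)

  p : Word → PFm
  p u = varᵖ (inj₂ u)

  trw : Word → WFm → PFm
  trw w ⊤ʷ = ⊤ᵖ
  trw w (varʷ q) = varᵖ (inj₁ q)
  trw w (¬ʷ φ) = ¬ᵖ (trw w φ)
  trw w (φ ∧ʷ ψ) = trw w φ ∧ᵖ trw w ψ
  trw w (Kʷ i φ) = Kᵖ i (trw w φ)
  trw w ([ a ]ʷ φ) = [ p (w ++ a ∷ []) !] trw (w ++ a ∷ []) φ

  tr : WFm → PFm
  tr = trw []

-- Updating by a letter c keeps the states where c is a possible next
-- observation, which is what announcing p_{wc} does if p_u marks the observable
-- prefixes u. A formula of modal depth m only sees prefixes of length ≤ m, so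
-- a bisimulation under which "u is observable at a" matches "p_{w u₁},
-- p_{w u₁ u₂}, …, p_{w u} hold at b" for |u| ≤ m survives updates and makes φ
-- and tr_w(φ) agree. Both directions use such a bisimulation on one frame:
-- read p_u off Exp, or conversely let Exp(s) generate the words all of whose
-- prefixes are marked at s, truncated at the depth of φ so that it is finite.
module Submission where

open import Defs
open import Data.Nat using (ℕ; zero; suc; _≤_; _⊔_; z≤n; s≤s)
open import Data.Nat.Properties using (m⊔n≤o⇒m≤o; m⊔n≤o⇒n≤o; ≤-refl)
open import Data.Fin as Fin using (Fin)
open import Data.Fin.Properties using (_≟_)
open import Data.List using ([]; _∷_; _++_; [_]; length)
open import Data.List.Properties using (++-assoc; ++-identityʳ)
open import Data.Bool using (Bool; true; false; if_then_else_)
open import Data.Product using (∃; _×_; _,_; proj₁; proj₂)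
open import Data.Product.Function.NonDependent.Propositional using (_×-⇔_)
open import Data.Sum using (inj₁; inj₂)
open import Data.Empty using (⊥-elim)
open import Data.Unit using (⊤; tt)
open import Function.Base using (_∘_)
open import Function.Bundles using (_⇔_; _↣_; mk⇔; Equivalence)
open import Function.Related.TypeIsomorphisms using (¬-cong-⇔)
import Relation.Binary.PropositionalEquality as ≡
open ≡ using (_≡_; refl; subst)
open import Relation.Nullary using (Dec; yes; no; does)

open Equivalence using (to; from)

module _ (n k : ℕ) (P : Set) where
  open Logic n k P

  nullable-sound : ∀ π → nullable π ≡ true → [] ∈L π
  nullable-sound εₒ _ = refl
  nullable-sound (π₁ · π₂) e with nullable π₁ in e₁
  ... | true = [] , [] , refl , nullable-sound π₁ e₁ , nullable-sound π₂ e
  nullable-sound (π₁ ⊕ π₂) e with nullable π₁ in e₁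
  ... | true = inj₁ (nullable-sound π₁ e₁)
  ... | false = inj₂ (nullable-sound π₂ e)

  deriv₁-sound : ∀ π a v → v ∈L deriv₁ π a → (a ∷ v) ∈L π
  deriv₁-sound (sym b) a v h with a ≟ b
  deriv₁-sound (sym b) a [] h | yes refl = refl
  deriv₁-sound (π₁ · π₂) a v (inj₁ (x , y , refl , h₁ , h₂)) =
    a ∷ x , y , refl , deriv₁-sound π₁ a x h₁ , h₂
  deriv₁-sound (π₁ · π₂) a v (inj₂ h) with nullable π₁ in e₁
  ... | true = [] , a ∷ v , refl , nullable-sound π₁ e₁ , deriv₁-sound π₂ a v h
  deriv₁-sound (π₁ ⊕ π₂) a v (inj₁ h) = inj₁ (deriv₁-sound π₁ a v h)
  deriv₁-sound (π₁ ⊕ π₂) a v (inj₂ h) = inj₂ (deriv₁-sound π₂ a v h)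

  deriv-sound : ∀ π w v → v ∈L deriv π w → (w ++ v) ∈L π
  deriv-sound π [] v h = h
  deriv-sound π (a ∷ w) v h =
    deriv₁-sound π a (w ++ v) (deriv-sound (deriv₁ π a) w v h)

  Pre-deriv : ∀ π w u → Pre (deriv π w) u ⇔ Pre π (w ++ u)
  Pre-deriv π w u = mk⇔
    (λ (v , h) → v , subst (_∈L π) (≡.sym (++-assoc w u v)) (deriv-sound π w (u ++ v) h))
    (λ (v , h) → v , deriv-complete π w (u ++ v) (subst (_∈L π) (++-assoc w u v) h))

  Pre-++⁻ˡ : ∀ π u v → Pre π (u ++ v) → Pre π u
  Pre-++⁻ˡ π u v (x , h) = v ++ x , subst (_∈L π) (++-assoc u v x) h

  nonEmpty? : ∀ π → Dec (∃ λ v → v ∈L π)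
  nonEmpty? ∅ₒ = no λ ()
  nonEmpty? εₒ = yes ([] , refl)
  nonEmpty? (sym a) = yes ([ a ] , refl)
  nonEmpty? (π₁ · π₂) with nonEmpty? π₁ | nonEmpty? π₂
  ... | yes (x , hx) | yes (y , hy) = yes (x ++ y , x , y , refl , hx , hy)
  ... | no ¬h₁ | _ = no λ (_ , x , _ , _ , hx , _) → ¬h₁ (x , hx)
  ... | yes _ | no ¬h₂ = no λ (_ , _ , y , _ , _ , hy) → ¬h₂ (y , hy)
  nonEmpty? (π₁ ⊕ π₂) with nonEmpty? π₁ | nonEmpty? π₂
  ... | yes (x , hx) | _ = yes (x , inj₁ hx)
  ... | no _ | yes (y , hy) = yes (y , inj₂ hy)
  ... | no ¬h₁ | no ¬h₂ = no λ where
    (x , inj₁ h) → ¬h₁ (x , h)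
    (x , inj₂ h) → ¬h₂ (x , h)

  Pre? : ∀ π w → Dec (Pre π w)
  Pre? π w with nonEmpty? (deriv π w)
  ... | yes (v , h) = yes (v , deriv-sound π w v h)
  ... | no ¬h = no λ (v , h) → ¬h (v , deriv-complete π w v h)

  does-Pre? : ∀ π w → (does (Pre? π w) ≡ true) ⇔ Pre π w
  does-Pre? π w with Pre? π w
  ... | yes h = mk⇔ (λ _ → h) (λ _ → refl)
  ... | no ¬h = mk⇔ (λ ()) (λ h → ⊥-elim (¬h h))

  Marked : (PVar → Bool) → Word → Word → Set
  Marked V w [] = ⊤
  Marked V w (c ∷ u) = (V (inj₂ (w ++ [ c ])) ≡ true) × Marked V (w ++ [ c ]) u

  Pre⇔Marked : ∀ {V π} → (∀ x → (V (inj₂ x) ≡ true) ⇔ Pre π x) →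
    ∀ w u → Pre π w → Pre π (w ++ u) ⇔ Marked V w u
  Pre⇔Marked {π = π} _ w [] pw =
    mk⇔ (λ _ → tt) (λ _ → subst (Pre π) (≡.sym (++-identityʳ w)) pw)
  Pre⇔Marked {π = π} V⇔Pre w (c ∷ u) pw = mk⇔
    (λ h → let h′ = reassoc h ; pwc = Pre-++⁻ˡ π (w ++ [ c ]) u h′ in
      from (V⇔Pre _) pwc , to (Pre⇔Marked V⇔Pre (w ++ [ c ]) u pwc) h′)
    (λ (e , m) → let pwc = to (V⇔Pre _) e in
      subst (Pre π) (++-assoc w [ c ] u) (from (Pre⇔Marked V⇔Pre (w ++ [ c ]) u pwc) m))
    where
    reassoc : Pre π (w ++ c ∷ u) → Pre π ((w ++ [ c ]) ++ u)
    reassoc = subst (Pre π) (≡.sym (++-assoc w [ c ] u))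

  depth : WFm → ℕ
  depth ⊤ʷ = 0
  depth (varʷ _) = 0
  depth (¬ʷ φ) = depth φ
  depth (φ ∧ʷ ψ) = depth φ ⊔ depth ψ
  depth (Kʷ _ φ) = depth φ
  depth ([ _ ]ʷ φ) = suc (depth φ)

  record Correspondence (A : EEModel) (B : EModel) (w : Word) (m : ℕ) : Set₁ where
    module A = EEModel A
    module B = EModel B
    field
      Z     : A.S → B.S → Set
      forth : ∀ {a b} i a′ → Z a b → A.R i a a′ → ∃ λ b′ → B.R i b b′ × Z a′ b′
      back  : ∀ {a b} i b′ → Z a b → B.R i b b′ → ∃ λ a′ → A.R i a a′ × Z a′ b′
      atoms : ∀ {a b} → Z a b → ∀ q → A.V a q ≡ B.V b (inj₁ q)
      prefixes : ∀ {a b} → Z a b → ∀ u → length u ≤ m →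
                 Pre (A.Exp a) u ⇔ Marked (B.V b) w u

  module _ {A B w m} (ρ : Correspondence A B w (suc m)) where
    open Correspondence ρ

    announces : ∀ {a b} → Z a b → ∀ c →
      Pre (A.Exp a) [ c ] ⇔ (B.V b (inj₂ (w ++ [ c ])) ≡ true)
    announces z c = mk⇔
      (proj₁ ∘ to (prefixes z [ c ] (s≤s z≤n)))
      (from (prefixes z [ c ] (s≤s z≤n)) ∘ (_, tt))

    Correspondence-update : ∀ c →
      Correspondence (A ∣ [ c ]) (restrictBy B (λ t → B , t ⊨ᵖ p (w ++ [ c ]))) (w ++ [ c ]) m
    Correspondence-update c = record
      { Z = λ (a , _) (b , _) → Z a b
      ; forth = λ i (a′ , h′) z r → let (b′ , r′ , z′) = forth i a′ z r in
          (b′ , to (announces z′ c) h′) , r′ , z′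
      ; back = λ i (b′ , h′) z r → let (a′ , r′ , z′) = back i b′ z r in
          (a′ , from (announces z′ c) h′) , r′ , z′
      ; atoms = atoms
      ; prefixes = λ {(a , _)} {(_ , pb)} z u len → mk⇔
          (λ h → proj₂ (to (prefixes z (c ∷ u) (s≤s len)) (to (Pre-deriv (A.Exp a) [ c ] u) h)))
          (λ mk → from (Pre-deriv (A.Exp a) [ c ] u) (from (prefixes z (c ∷ u) (s≤s len)) (pb , mk)))
      }

  tr-correct : ∀ φ {A B w m} (ρ : Correspondence A B w m) → depth φ ≤ m →
    ∀ {a b} → Correspondence.Z ρ a b → (A , a ⊨ embed φ) ⇔ (B , b ⊨ᵖ trw w φ)
  tr-correct ⊤ʷ ρ d z = mk⇔ (λ _ → tt) (λ _ → tt)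
  tr-correct (varʷ q) ρ d z = mk⇔ (subst (_≡ true) e) (subst (_≡ true) (≡.sym e))
    where e = Correspondence.atoms ρ z q
  tr-correct (¬ʷ φ) ρ d z = ¬-cong-⇔ (tr-correct φ ρ d z)
  tr-correct (φ ∧ʷ ψ) ρ d z =
    tr-correct φ ρ (m⊔n≤o⇒m≤o (depth φ) (depth ψ) d) z ×-⇔
    tr-correct ψ ρ (m⊔n≤o⇒n≤o (depth φ) (depth ψ) d) z
  tr-correct (Kʷ i φ) ρ d z = mk⇔
    (λ hA b′ r → let (a′ , r′ , z′) = Correspondence.back ρ i b′ z r in
       to (tr-correct φ ρ d z′) (hA a′ r′))
    (λ hB a′ r → let (b′ , r′ , z′) = Correspondence.forth ρ i a′ z r in
       from (tr-correct φ ρ d z′) (hB b′ r′))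
  tr-correct ([ c ]ʷ φ) ρ (s≤s d) z = mk⇔
    (λ hA hb → let ha = from (announces ρ z c) hb in
       to (tr-correct φ ρ′ d z) (hA [ c ] refl ha))
    (λ { hB .([ c ]) refl ha → from (tr-correct φ ρ′ d z) (hB (to (announces ρ z c) ha)) })
    where ρ′ = Correspondence-update ρ c

  frameOf : (A : EEModel) → (EEModel.S A → PVar → Bool) → EModel
  frameOf A val = record { S = S ; R = R ; equiv = equiv ; V = val }
    where open EEModel A

  Correspondence-diagonal : ∀ A V {m} → (∀ a q → EEModel.V A a q ≡ V a (inj₁ q)) →
    (∀ a u → length u ≤ m → Pre (EEModel.Exp A a) u ⇔ Marked (V a) [] u) →
    Correspondence A (frameOf A V) [] m
  Correspondence-diagonal A V atoms prefixes = record
    { Z = _≡_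
    ; forth = λ { i a′ refl r → a′ , r , refl }
    ; back = λ { i a′ refl r → a′ , r , refl }
    ; atoms = λ { {a} refl → atoms a }
    ; prefixes = λ { {a} refl → prefixes a }
    }

  expectationValuation : (A : EEModel) → EEModel.S A → PVar → Bool
  expectationValuation A a (inj₁ q) = EEModel.V A a q
  expectationValuation A a (inj₂ u) = does (Pre? (EEModel.Exp A a) u)

  SatPOL⇒SatPAL : ∀ φ → SatPOL (embed φ) → SatPAL (tr φ)
  SatPOL⇒SatPAL φ (A , a , h) = frameOf A V , a , to (tr-correct φ ρ ≤-refl refl) h
    where
    V : EEModel.S A → PVar → Bool
    V = expectationValuation A
    ρ : Correspondence A (frameOf A V) [] (depth φ)
    ρ = Correspondence-diagonal A V (λ _ _ → refl) λ a u _ →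
      Pre⇔Marked (does-Pre? (EEModel.Exp A a)) [] u (EEModel.Exp-ne A a)

  ⨁ : ∀ j → (Fin j → Obs) → Obs
  ⨁ zero f = ∅ₒ
  ⨁ (suc j) f = f Fin.zero ⊕ ⨁ j (f ∘ Fin.suc)

  ∈L-⨁ : ∀ j f x → x ∈L ⨁ j f ⇔ (∃ λ c → x ∈L f c)
  ∈L-⨁ j f x = mk⇔ (⨁⁺ j f) (λ (c , h) → ⨁⁻ j f c h)
    where
    ⨁⁺ : ∀ j f → x ∈L ⨁ j f → ∃ λ c → x ∈L f c
    ⨁⁺ (suc j) f (inj₁ h) = Fin.zero , h
    ⨁⁺ (suc j) f (inj₂ h) = let (c , h′) = ⨁⁺ j (f ∘ Fin.suc) h in Fin.suc c , h′
    ⨁⁻ : ∀ j f c → x ∈L f c → x ∈L ⨁ j f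
    ⨁⁻ (suc j) f Fin.zero h = inj₁ h
    ⨁⁻ (suc j) f (Fin.suc c) h = inj₂ (⨁⁻ j (f ∘ Fin.suc) c h)

  guard : Bool → Obs → Obs
  guard b π = if b then π else ∅ₒ

  ∈L-guard : ∀ b π x → x ∈L guard b π ⇔ ((b ≡ true) × x ∈L π)
  ∈L-guard true π x = mk⇔ (refl ,_) proj₂
  ∈L-guard false π x = mk⇔ (λ ()) (λ ())

  markedWords : (PVar → Bool) → Word → ℕ → Obs
  markedWords V w zero = εₒ
  markedWords V w (suc m) =
    εₒ ⊕ ⨁ k λ c → guard (V (inj₂ (w ++ [ c ]))) (sym c · markedWords V (w ++ [ c ]) m)

  []∈markedWords : ∀ V w m → [] ∈L markedWords V w m
  []∈markedWords V w zero = refl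
  []∈markedWords V w (suc m) = inj₁ refl

  Pre-markedWords : ∀ V w m u → length u ≤ m → Pre (markedWords V w m) u ⇔ Marked V w u
  Pre-markedWords V w m [] _ = mk⇔ (λ _ → tt) (λ _ → [] , []∈markedWords V w m)
  Pre-markedWords V w (suc m) (c ∷ u) (s≤s len) = mk⇔ marked observable
    where
    ih : Pre (markedWords V (w ++ [ c ]) m) u ⇔ Marked V (w ++ [ c ]) u
    ih = Pre-markedWords V (w ++ [ c ]) m u len
    branch : Fin k → Obs
    branch c′ = guard (V (inj₂ (w ++ [ c′ ]))) (sym c′ · markedWords V (w ++ [ c′ ]) m)

    marked : Pre (markedWords V w (suc m)) (c ∷ u) → Marked V w (c ∷ u)
    marked (v , inj₂ h) with to (∈L-⨁ k branch (c ∷ u ++ v)) h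
    ... | c′ , h′ with to (∈L-guard _ (sym c′ · markedWords V (w ++ [ c′ ]) m) _) h′
    ... | e , (_ , _ , refl , refl , hy) = e , to ih (v , hy)

    observable : Marked V w (c ∷ u) → Pre (markedWords V w (suc m)) (c ∷ u)
    observable (e , mk) = let (v , hv) = from ih mk in
      v , inj₂ (from (∈L-⨁ k branch (c ∷ u ++ v))
        (c , from (∈L-guard _ _ _) (e , [ c ] , u ++ v , refl , refl , hv)))

  markedWordsModel : ℕ → EModel → EEModel
  markedWordsModel m B = record
    { S = S ; R = R ; equiv = equiv ; V = λ s q → V s (inj₁ q)
    ; Exp = λ s → markedWords (V s) [] m
    ; Exp-ne = λ s → [] , []∈markedWords (V s) [] m
    }
    where open EModel B

  SatPAL⇒SatPOL : ∀ φ → SatPAL (tr φ) → SatPOL (embed φ)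
  SatPAL⇒SatPOL φ (B , b , h) = A , b , from (tr-correct φ ρ ≤-refl refl) h
    where
    A : EEModel
    A = markedWordsModel (depth φ) B
    ρ : Correspondence A B [] (depth φ)
    ρ = Correspondence-diagonal A (EModel.V B) (λ _ _ → refl) λ a →
      Pre-markedWords (EModel.V B a) [] (depth φ)

proposition1 : (n k : ℕ) (P : Set) → (P ↣ ℕ) → (φ : Logic.WFm n k P) →
    Logic.SatPOL n k P (Logic.embed n k P φ) ⇔ Logic.SatPAL n k P (Logic.tr n k P φ)
proposition1 n k P _ φ = mk⇔ (SatPOL⇒SatPAL n k P φ) (SatPAL⇒SatPOL n k P φ)
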